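{- Let $G$ be a tree-path intersection graph with the rooting and order $\le$ described in the context. If $s_1,s_2,s_3\in\Gamma(s_0)$ and $\min\Gamma(s_0)<s_1\le s_2$ and $s_1\le s_3$, then $s_2$ and $s_3$ are comparable.
   Context: A tree-path intersection graph is a connected bipartite graph $G$ with disjoint parts $G_H$, $G_V$, together with a tree $T_H$ on vertex set $G_H$ and a tree $T_V$ on vertex set $G_V$, such that for every $h\in G_H$ the neighbourhood $\Gamma(h)$ of $h$ in $G$ is the vertex set of a path in $T_V$, and for every $v\in G_V$ the neighbourhood $\Gamma(v)$ is the vertex set of a path in $T_H$. Fix an edge $h_{\mathrm{root}}v_{\mathrm{root}}\in E(G)$ such that $v_{\mathrm{root}}$ is a leaf of $T_V$; root $T_H$ at $h_{\mathrm{root}}$ and $T_V$ at $v_{\mathrm{root}}$. For $s_1,s_2$ both in $G_H$ (resp. both in $G_V$), $s_1\le s_2$ iff $s_1$ lies on the path of $T_H$ (resp. $T_V$) from the root to $s_2$; vertices from different sides are incomparable; $<$ is the strict version; $s_1,s_2$ are comparable if $s_1\le s_2$ or $s_2\le s_1$. $\min\Gamma(s)$ denotes the unique $\le$-minimal element of $\Gamma(s)$ (it exists since $\Gamma(s)$ is a path in a rooted tree). -}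

module Defs where

open import Data.Nat using (ℕ; _≤_)
open import Data.Fin using (Fin)
open import Data.Sum using (_⊎_; inj₁; inj₂)
open import Data.Product using (Σ; ∃; _×_; _,_)
open import Data.Empty using (⊥)
open import Data.Maybe using (Maybe; just)
open import Data.List using (List; []; _∷_; _++_; [_]; head; last; length)
open import Data.List.Membership.Propositional using (_∈_)
open import Data.List.Relation.Unary.Linked using (Linked)
open import Data.List.Relation.Unary.Unique.Propositional using (Unique)
open import Relation.Binary.PropositionalEquality using (_≡_)
open import Relation.Nullary using (¬_)
open import Function.Bundles using (_⇔_)

record IsPath {V : Set} (A : V → V → Set) (xs : List V) : Set where
  field
    nonempty : 1 ≤ length xs
    linked   : Linked A xs
    distinct : Unique xs

record PathBetween {V : Set} (A : V → V → Set) (x y : V) : Set where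
  field
    verts   : List V
    isPath  : IsPath A verts
    starts  : head verts ≡ just x
    ends    : last verts ≡ just y

IsCycle : {V : Set} (A : V → V → Set) → List V → Set
IsCycle A []       = ⊥
IsCycle A (x ∷ xs) =
  Unique (x ∷ xs) × (3 ≤ length (x ∷ xs)) × Linked A ((x ∷ xs) ++ [ x ])

record IsTree {V : Set} (A : V → V → Set) : Set where
  field
    sym       : ∀ x y → A x y → A y x
    irrefl    : ∀ x → ¬ A x x
    connected : ∀ x y → PathBetween A x y
    acyclic   : ∀ xs → ¬ IsCycle A xs

IsPathVertexSet : {V : Set} (A : V → V → Set) (P : V → Set) → Set
IsPathVertexSet {V} A P = Σ (List V) λ xs → IsPath A xs × (∀ v → (v ∈ xs) ⇔ P v)

-- Leaf: at most one neighbour (so the vertex of a one-vertex tree is a leaf).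
IsLeaf : {V : Set} (A : V → V → Set) (x : V) → Set
IsLeaf A x = ∀ u w → A x u → A x w → u ≡ w

BipAdj : {nH nV : ℕ} → (Fin nH → Fin nV → Set) → Fin nH ⊎ Fin nV → Fin nH ⊎ Fin nV → Set
BipAdj E (inj₁ h) (inj₂ v) = E h v
BipAdj E (inj₂ v) (inj₁ h) = E h v
BipAdj E (inj₁ _) (inj₁ _) = ⊥
BipAdj E (inj₂ _) (inj₂ _) = ⊥

record TPIG (nH nV : ℕ) : Set₁ where
  field
    E     : Fin nH → Fin nV → Set
    TH    : Fin nH → Fin nH → Set
    TV    : Fin nV → Fin nV → Set
    G-connected : ∀ x y → PathBetween (BipAdj E) x y
    TH-tree : IsTree TH
    TV-tree : IsTree TV
    Γh-path : ∀ h → IsPathVertexSet TV (λ v → E h v)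
    Γv-path : ∀ v → IsPathVertexSet TH (λ h → E h v)
    hroot : Fin nH
    vroot : Fin nV
    root-edge : E hroot vroot
    vroot-leaf : IsLeaf TV vroot

module TPIGOrder {nH nV : ℕ} (G : TPIG nH nV) where
  open TPIG G

  Vtx : Set
  Vtx = Fin nH ⊎ Fin nV

  Γ : Vtx → Vtx → Set
  Γ = BipAdj E

  -- x ≤T y : x lies on the path of tree A from root r to y
  -- (paths in a tree are unique, so "some path" = "the path").
  OnRootPath : {W : Set} (A : W → W → Set) (r : W) → W → W → Set
  OnRootPath A r x y = Σ (PathBetween A r y) λ p → x ∈ PathBetween.verts p

  _≤ᵍ_ : Vtx → Vtx → Set
  inj₁ a ≤ᵍ inj₁ b = OnRootPath TH hroot a b
  inj₂ a ≤ᵍ inj₂ b = OnRootPath TV vroot a b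
  inj₁ _ ≤ᵍ inj₂ _ = ⊥
  inj₂ _ ≤ᵍ inj₁ _ = ⊥

  _<ᵍ_ : Vtx → Vtx → Set
  x <ᵍ y = (x ≤ᵍ y) × ¬ (x ≡ y)

  Comparable : Vtx → Vtx → Set
  Comparable x y = (x ≤ᵍ y) ⊎ (y ≤ᵍ x)

  IsMinΓ : Vtx → Vtx → Set
  IsMinΓ s m = Γ s m × (∀ t → Γ s t → m ≤ᵍ t)

{-# OPTIONS --safe #-}
module Submission where

-- Γ(s₀) is a path P in a tree and m = min P lies on the root path of every vertex of P, so P
-- splits at m into two arms m ∷ R and m ∷ reverse L. Paths in a tree are unique, hence the root
-- path of a vertex z on an arm is the root path of m followed by the arm up to z: vertices on
-- one arm are pairwise comparable, and a vertex above some s₁ ≠ m of an arm lies on that arm.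
-- So s₂ and s₃ lie on the arm of s₁.

open import Defs
open import Data.Nat using (ℕ; _≤_; s≤s; z≤n)
import Data.Fin.Properties as Fin
open import Data.Sum using (_⊎_; inj₁; inj₂)
import Data.Sum as Sum
open import Data.Product using (Σ; ∃; _×_; _,_; proj₁; proj₂)
open import Data.Empty using (⊥-elim)
open import Data.Maybe using (just)
open import Data.Maybe.Properties using (just-injective)
open import Data.List using (List; []; _∷_; _++_; [_]; _∷ʳ_; head; last; length; reverse)
open import Data.List.Properties
  using (++-assoc; ++-cancelʳ; unfold-reverse; reverse-++; length-reverse; ∷-injectiveˡ; ∷-injectiveʳ)
open import Data.List.Membership.Propositional using (_∈_; _∉_)
open import Data.List.Membership.Propositional.Properties using (∈-++⁺ˡ; ∈-++⁺ʳ; ∈-++⁻; ∈-∃++)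
open import Data.List.Relation.Unary.Any using (here; there)
import Data.List.Relation.Unary.Any.Properties as Any
import Data.List.Relation.Unary.All as All
import Data.List.Relation.Unary.All.Properties as All
open import Data.List.Relation.Unary.All.Properties using (¬Any⇒All¬)
open import Data.List.Relation.Unary.First as First using (FirstView; first)
open import Data.List.Relation.Unary.First.Properties using (toView)
open import Data.List.Relation.Unary.Linked using (Linked; []; [-]; _∷_)
open import Data.List.Relation.Unary.Unique.Propositional using (Unique; []; _∷_)
import Data.List.Relation.Unary.Unique.Propositional.Properties as Unique
open import Data.List.Relation.Unary.Unique.Propositional.Properties using (Unique[x∷xs]⇒x∉xs)
open import Data.List.Relation.Binary.Disjoint.Propositional using (Disjoint)
import Data.List.Relation.Binary.Disjoint.Propositional.Properties as Disjoint
open import Function using (case_of_; _∘_)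
open import Function.Bundles using (Equivalence)
open import Relation.Nullary using (yes; no)
open import Relation.Nullary.Decidable using (toSum)
open import Relation.Binary.Definitions using (DecidableEquality; Symmetric)
open import Relation.Binary.PropositionalEquality
  using (_≡_; _≢_; refl; sym; trans; cong; cong₂; subst; module ≡-Reasoning)
open import Relation.Binary.PropositionalEquality.Properties using (setoid)

module _ {V : Set} where

  last-∷ʳ : ∀ (xs : List V) {y} → last (xs ∷ʳ y) ≡ just y
  last-∷ʳ []            = refl
  last-∷ʳ (x ∷ [])      = refl
  last-∷ʳ (x ∷ x′ ∷ xs) = last-∷ʳ (x′ ∷ xs)

  last-++-∷ : ∀ (xs : List V) {y ys} → last (xs ++ y ∷ ys) ≡ last (y ∷ ys)
  last-++-∷ []            = refl
  last-++-∷ (x ∷ [])      = refl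
  last-++-∷ (x ∷ x′ ∷ xs) = last-++-∷ (x′ ∷ xs)

  head-++-∷ : ∀ (xs : List V) {y ys zs} → head (xs ++ y ∷ ys) ≡ head (xs ++ y ∷ zs)
  head-++-∷ []       = refl
  head-++-∷ (x ∷ xs) = refl

  last⇒∈ : ∀ {xs : List V} {y} → last xs ≡ just y → y ∈ xs
  last⇒∈ {x ∷ []}      refl = here refl
  last⇒∈ {x ∷ x′ ∷ xs} e    = there (last⇒∈ e)

  last⇒∷ʳ : ∀ {xs : List V} {y} → last xs ≡ just y → ∃ λ ys → xs ≡ ys ∷ʳ y
  last⇒∷ʳ {x ∷ []}      refl = [] , refl
  last⇒∷ʳ {x ∷ x′ ∷ xs} e with last⇒∷ʳ e
  ... | ys , eq = x ∷ ys , cong (x ∷_) eq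

  ∃-last : ∀ (x : V) xs → ∃ λ y → last (x ∷ xs) ≡ just y
  ∃-last x []        = x , refl
  ∃-last x (x′ ∷ xs) = ∃-last x′ xs

  reverse-∷ʳ : ∀ xs {y : V} → reverse (xs ∷ʳ y) ≡ y ∷ reverse xs
  reverse-∷ʳ xs {y} = reverse-++ xs [ y ]

  length-++-∷-pos : ∀ xs {y : V} {ys} → 1 ≤ length (xs ++ y ∷ ys)
  length-++-∷-pos []      = s≤s z≤n
  length-++-∷-pos (_ ∷ _) = s≤s z≤n

  ∈-∷ʳ⇒∈-++-∷ : ∀ xs {x y : V} {ys} → x ∈ xs ∷ʳ y → x ∈ xs ++ y ∷ ys
  ∈-∷ʳ⇒∈-++-∷ xs {ys = ys} p = subst (_ ∈_) (++-assoc xs _ ys) (∈-++⁺ˡ p)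

  ∈-++-∷-comparable : ∀ pre₁ pre₂ {x₁ x₂ : V} {post₁ post₂} →
    pre₁ ++ x₁ ∷ post₁ ≡ pre₂ ++ x₂ ∷ post₂ → x₁ ∈ pre₂ ∷ʳ x₂ ⊎ x₂ ∈ pre₁ ∷ʳ x₁
  ∈-++-∷-comparable []         []         e = inj₁ (here (∷-injectiveˡ e))
  ∈-++-∷-comparable []         (_ ∷ _)    e = inj₁ (here (∷-injectiveˡ e))
  ∈-++-∷-comparable (_ ∷ _)    []         e = inj₂ (here (sym (∷-injectiveˡ e)))
  ∈-++-∷-comparable (_ ∷ pre₁) (_ ∷ pre₂) e =
    Sum.map there there (∈-++-∷-comparable pre₁ pre₂ (∷-injectiveʳ e))

  Unique-++⁻ˡ : ∀ xs {ys : List V} → Unique (xs ++ ys) → Unique xs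
  Unique-++⁻ˡ []       _       = []
  Unique-++⁻ˡ (_ ∷ xs) (p ∷ u) = All.++⁻ˡ xs p ∷ Unique-++⁻ˡ xs u

  Unique-++⁻ʳ : ∀ xs {ys : List V} → Unique (xs ++ ys) → Unique ys
  Unique-++⁻ʳ []       u       = u
  Unique-++⁻ʳ (_ ∷ xs) (_ ∷ u) = Unique-++⁻ʳ xs u

  Unique-++⇒Disjoint : ∀ xs {ys : List V} → Unique (xs ++ ys) → Disjoint xs ys
  Unique-++⇒Disjoint (_ ∷ xs) (x∉ ∷ _) (here refl , q) = All.lookup (All.++⁻ʳ xs x∉) q refl
  Unique-++⇒Disjoint (_ ∷ xs) (_ ∷ u)  (there p , q)   = Unique-++⇒Disjoint xs u (p , q)

  reverse-++-∷ : ∀ xs {y : V} ys → reverse (xs ++ y ∷ ys) ≡ reverse ys ++ y ∷ reverse xs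
  reverse-++-∷ xs {y} ys = begin
    reverse (xs ++ y ∷ ys)              ≡⟨ reverse-++ xs (y ∷ ys) ⟩
    reverse (y ∷ ys) ++ reverse xs      ≡⟨ cong (_++ reverse xs) (unfold-reverse y ys) ⟩
    (reverse ys ∷ʳ y) ++ reverse xs     ≡⟨ ++-assoc (reverse ys) [ y ] (reverse xs) ⟩
    reverse ys ++ y ∷ reverse xs        ∎
    where open ≡-Reasoning

  ∈-++-∷⁻ : ∀ xs {y z : V} {ys} → z ∈ xs ++ y ∷ ys → z ∈ y ∷ ys ⊎ z ∈ y ∷ reverse xs
  ∈-++-∷⁻ xs z∈ with ∈-++⁻ xs z∈
  ... | inj₁ z∈xs = inj₂ (there (Any.reverse⁺ z∈xs))
  ... | inj₂ z∈   = inj₁ z∈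

  ∈-∷-reverse⇒∈-++-∷ : ∀ xs {y z : V} {ys} → z ∈ y ∷ reverse xs → z ∈ xs ++ y ∷ ys
  ∈-∷-reverse⇒∈-++-∷ xs (here refl) = ∈-++⁺ʳ xs (here refl)
  ∈-∷-reverse⇒∈-++-∷ xs (there z∈)  = ∈-++⁺ˡ (Any.reverse⁻ {xs = xs} z∈)

  Unique-++-∷⇒Disjoint : ∀ xs {y : V} {ys} → Unique (xs ++ y ∷ ys) → Disjoint ys (reverse xs)
  Unique-++-∷⇒Disjoint xs u (z∈ys , z∈xs) =
    Unique-++⇒Disjoint xs u (Any.reverse⁻ {xs = xs} z∈xs , there z∈ys)

  open import Data.List.Relation.Binary.Permutation.Setoid (setoid V) using (↭-sym)
  open import Data.List.Relation.Binary.Permutation.Setoid.Properties (setoid V)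
    using (Unique-resp-↭; ↭-reverse)

  Unique-reverse : ∀ {xs : List V} → Unique xs → Unique (reverse xs)
  Unique-reverse {xs} = Unique-resp-↭ (↭-sym (↭-reverse xs))

  module _ {R : V → V → Set} where

    Linked-++⁻ˡ : ∀ xs {ys} → Linked R (xs ++ ys) → Linked R xs
    Linked-++⁻ˡ []            _       = []
    Linked-++⁻ˡ (x ∷ [])      _       = [-]
    Linked-++⁻ˡ (x ∷ x′ ∷ xs) (r ∷ l) = r ∷ Linked-++⁻ˡ (x′ ∷ xs) l

    Linked-++⁻ʳ : ∀ xs {ys} → Linked R (xs ++ ys) → Linked R ys
    Linked-++⁻ʳ []            l       = l
    Linked-++⁻ʳ (x ∷ [])      [-]     = []
    Linked-++⁻ʳ (x ∷ [])      (_ ∷ l) = l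
    Linked-++⁻ʳ (x ∷ x′ ∷ xs) (_ ∷ l) = Linked-++⁻ʳ (x′ ∷ xs) l

    Linked-glue : ∀ xs {y ys} → Linked R (xs ∷ʳ y) → Linked R (y ∷ ys) → Linked R (xs ++ y ∷ ys)
    Linked-glue []            _       l′ = l′
    Linked-glue (x ∷ [])      (r ∷ _) l′ = r ∷ l′
    Linked-glue (x ∷ x′ ∷ xs) (r ∷ l) l′ = r ∷ Linked-glue (x′ ∷ xs) l l′

    Linked-reverse : Symmetric R → ∀ {xs} → Linked R xs → Linked R (reverse xs)
    Linked-reverse s []                    = []
    Linked-reverse s [-]                   = [-]
    Linked-reverse s {x ∷ y ∷ xs} (r ∷ l) = subst (Linked R) (sym (reverse-++-∷ [ x ] xs))
      (Linked-glue (reverse xs) (subst (Linked R) (unfold-reverse y xs) (Linked-reverse s l)) (s r ∷ [-]))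

SimplePath : {V : Set} → (V → V → Set) → List V → Set
SimplePath R xs = Linked R xs × Unique xs

module _ {V : Set} {R : V → V → Set} where

  SimplePath-++⁻ˡ : ∀ xs {ys} → SimplePath R (xs ++ ys) → SimplePath R xs
  SimplePath-++⁻ˡ xs (l , u) = Linked-++⁻ˡ xs l , Unique-++⁻ˡ xs u

  SimplePath-++⁻ʳ : ∀ xs {ys} → SimplePath R (xs ++ ys) → SimplePath R ys
  SimplePath-++⁻ʳ xs (l , u) = Linked-++⁻ʳ xs l , Unique-++⁻ʳ xs u

  SimplePath-∷ʳ : ∀ xs {y ys} → SimplePath R (xs ++ y ∷ ys) → SimplePath R (xs ∷ʳ y)
  SimplePath-∷ʳ xs {y} {ys} p =
    SimplePath-++⁻ˡ (xs ∷ʳ y) (subst (SimplePath R) (sym (++-assoc xs [ y ] ys)) p)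

  SimplePath-reverse : Symmetric R → ∀ {xs} → SimplePath R xs → SimplePath R (reverse xs)
  SimplePath-reverse s (l , u) = Linked-reverse s l , Unique-reverse u

  SimplePath-split : Symmetric R → ∀ xs {y ys} → SimplePath R (xs ++ y ∷ ys) →
                     SimplePath R (y ∷ ys) × SimplePath R (y ∷ reverse xs)
  SimplePath-split s xs {ys = ys} p = SimplePath-++⁻ʳ xs p ,
    SimplePath-++⁻ʳ (reverse ys) (subst (SimplePath R) (reverse-++-∷ xs ys) (SimplePath-reverse s p))

module TreePaths {V : Set} (_≟_ : DecidableEquality V) {A : V → V → Set} (T : IsTree A) where
  open import Data.List.Membership.DecPropositional _≟_ using (_∈?_)

  first-common : ∀ {zs ws : List V} {y} → y ∈ zs → y ∈ ws → FirstView (_∉ ws) (_∈ ws) zs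
  first-common {zs} {ws} y∈zs y∈ws with first (λ z → Sum.swap (toSum (z ∈? ws))) zs
  ... | inj₁ f    = toView f
  ... | inj₂ ∉ws = ⊥-elim (All.lookup ∉ws y∈zs y∈ws)

  -- With v the first vertex of zs lying on ws, the cycle runs from x along zs to v and back along ws.
  fork⇒cycle : ∀ x {zs ws y} → SimplePath A (x ∷ zs) → SimplePath A (x ∷ ws) →
               head zs ≢ head ws → last zs ≡ just y → last ws ≡ just y → ∃ (IsCycle A)
  fork⇒cycle x {zs} {ws} pz pw heads≢ lz≡y lw≡y
    with first-common {zs} {ws} (last⇒∈ lz≡y) (last⇒∈ lw≡y)
  ... | First._++_∷_ {t} {v} t∉ws v∈ws rest with ∈-∃++ v∈ws
  ... | p , q , refl = x ∷ t ++ v ∷ reverse p , (x∉cycle ∷ unique) , long t p heads≢ , linked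
    where
    in-ws : ∀ {z} → z ∈ v ∷ reverse p → z ∈ p ++ v ∷ q
    in-ws (here refl) = ∈-++⁺ʳ p (here refl)
    in-ws (there z∈)  = ∈-++⁺ˡ {xs = p} (Any.reverse⁻ z∈)
    x∉cycle : All.All (x ≢_) (t ++ v ∷ reverse p)
    x∉cycle = ¬Any⇒All¬ _ λ x∈ → case ∈-++⁻ t x∈ of λ where
      (inj₁ x∈t) → Unique[x∷xs]⇒x∉xs (proj₂ pz) (∈-++⁺ˡ x∈t)
      (inj₂ x∈)  → Unique[x∷xs]⇒x∉xs (proj₂ pw) (in-ws x∈)
    unique : Unique (t ++ v ∷ reverse p)
    unique = Unique.++⁺ (Unique-++⁻ˡ t (Unique-++⁻ʳ [ x ] (proj₂ pz)))
      (subst Unique (reverse-∷ʳ p)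
        (Unique-reverse (proj₂ (SimplePath-∷ʳ p (SimplePath-++⁻ʳ [ x ] pw)))))
      λ (z∈t , z∈) → All.lookup t∉ws z∈t (in-ws z∈)
    long : ∀ t′ p′ {rest′ q′} → head (t′ ++ v ∷ rest′) ≢ head (p′ ++ v ∷ q′) →
           3 ≤ length (x ∷ t′ ++ v ∷ reverse p′)
    long []       []       heads≢ = ⊥-elim (heads≢ refl)
    long []       (u ∷ p′) _      = s≤s (s≤s (subst (1 ≤_) (sym (length-reverse (u ∷ p′))) (s≤s z≤n)))
    long (_ ∷ t′) _        _      = s≤s (s≤s (length-++-∷-pos t′))
    linked : Linked A ((x ∷ t ++ v ∷ reverse p) ∷ʳ x)
    linked = subst (Linked A) (sym (++-assoc (x ∷ t) (v ∷ reverse p) [ x ]))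
      (Linked-glue (x ∷ t) (proj₁ (SimplePath-∷ʳ (x ∷ t) pz))
        (subst (Linked A) (trans (reverse-∷ʳ (x ∷ p)) (cong (v ∷_) (unfold-reverse x p)))
          (proj₁ (SimplePath-reverse (IsTree.sym T _ _) (SimplePath-∷ʳ (x ∷ p) pw)))))

  SimplePath-unique-from : ∀ x {xs ys} → SimplePath A (x ∷ xs) → SimplePath A (x ∷ ys) →
                           last (x ∷ xs) ≡ last (x ∷ ys) → xs ≡ ys
  SimplePath-unique-from x {[]}     {[]}     _  _  _ = refl
  SimplePath-unique-from x {[]}     {_ ∷ _}  _  py e = ⊥-elim (Unique[x∷xs]⇒x∉xs (proj₂ py) (last⇒∈ (sym e)))
  SimplePath-unique-from x {_ ∷ _}  {[]}     px _  e = ⊥-elim (Unique[x∷xs]⇒x∉xs (proj₂ px) (last⇒∈ e))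
  SimplePath-unique-from x {a ∷ xs} {b ∷ ys} px py e with a ≟ b | ∃-last a xs
  ... | yes refl | _ =
    cong (a ∷_) (SimplePath-unique-from a (SimplePath-++⁻ʳ [ x ] px) (SimplePath-++⁻ʳ [ x ] py) e)
  ... | no a≢b | y , last≡y =
    ⊥-elim (IsTree.acyclic T _ (proj₂ (fork⇒cycle x px py (a≢b ∘ just-injective) last≡y (trans (sym e) last≡y))))

  SimplePath-unique : ∀ {xs ys} → SimplePath A xs → SimplePath A ys →
                      head xs ≡ head ys → last xs ≡ last ys → xs ≡ ys
  SimplePath-unique {[]}     {[]}      _  _  _    _ = refl
  SimplePath-unique {x ∷ xs} {.x ∷ ys} px py refl e = cong (x ∷_) (SimplePath-unique-from x px py e)

  PathBetween-simple : ∀ {x y} (p : PathBetween A x y) → SimplePath A (PathBetween.verts p)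
  PathBetween-simple p = IsPath.linked (PathBetween.isPath p) , IsPath.distinct (PathBetween.isPath p)

  module Rooted (r : V) where

    root-path : V → List V
    root-path y = PathBetween.verts (IsTree.connected T r y)

    module _ {y : V} where
      open PathBetween (IsTree.connected T r y)

      root-path-simple : SimplePath A (root-path y)
      root-path-simple = PathBetween-simple (IsTree.connected T r y)

      root-path-head : head (root-path y) ≡ just r
      root-path-head = starts

      root-path-last : last (root-path y) ≡ just y
      root-path-last = ends

    root-path-init : V → List V
    root-path-init y = proj₁ (last⇒∷ʳ {xs = root-path y} root-path-last)

    root-path-∷ʳ : ∀ y → root-path y ≡ root-path-init y ∷ʳ y
    root-path-∷ʳ y = proj₂ (last⇒∷ʳ {xs = root-path y} root-path-last)

    _≼_ : V → V → Set
    x ≼ y = Σ (PathBetween A r y) λ p → x ∈ PathBetween.verts p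

    ≼⇒∈-root-path : ∀ {x y} → x ≼ y → x ∈ root-path y
    ≼⇒∈-root-path (p , x∈p) = subst (_ ∈_) (SimplePath-unique (PathBetween-simple p) root-path-simple
      (trans (PathBetween.starts p) (sym root-path-head))
      (trans (PathBetween.ends p) (sym root-path-last))) x∈p

    ∈-root-path⇒≼ : ∀ {x y} → x ∈ root-path y → x ≼ y
    ∈-root-path⇒≼ {y = y} x∈ = IsTree.connected T r y , x∈

    -- Paths in a tree are unique, so the root path of z through m is the root path of m
    -- continued by any path from m to z.
    root-path-via : ∀ {m z Q} → m ∈ root-path z →
                    SimplePath A Q → head Q ≡ just m → last Q ≡ just z →
                    root-path z ≡ root-path-init m ++ Q
    root-path-via {m} {z} {Q} m∈ pQ hQ lQ with ∈-∃++ m∈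
    ... | w , w′ , split = trans split (cong₂ _++_ w≡init m∷w′≡Q)
      where
      path : SimplePath A (w ++ m ∷ w′)
      path = subst (SimplePath A) split root-path-simple
      w≡init : w ≡ root-path-init m
      w≡init = ++-cancelʳ [ m ] w (root-path-init m) (trans
        (SimplePath-unique (SimplePath-∷ʳ w path) root-path-simple
          (trans (head-++-∷ w) (trans (cong head (sym split)) (trans root-path-head (sym root-path-head))))
          (trans (last-∷ʳ w) (sym root-path-last)))
        (root-path-∷ʳ m))
      m∷w′≡Q : m ∷ w′ ≡ Q
      m∷w′≡Q = SimplePath-unique (SimplePath-++⁻ʳ w path) pQ (sym hQ)
        (trans (sym (last-++-∷ w)) (trans (cong last (sym split)) (trans root-path-last (sym lQ))))

    Arm : V → List V → Set
    Arm m xs = SimplePath A (m ∷ xs) × (∀ {t} → t ∈ m ∷ xs → m ∈ root-path t)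

    root-path-along-arm : ∀ {m xs} → Arm m xs → ∀ pre {z post} → m ∷ xs ≡ pre ++ z ∷ post →
                          root-path z ≡ root-path-init m ++ (pre ∷ʳ z)
    root-path-along-arm (path , above) pre split =
      root-path-via (above (subst (_ ∈_) (sym split) (∈-++⁺ʳ pre (here refl))))
        (SimplePath-∷ʳ pre (subst (SimplePath A) split path))
        (trans (head-++-∷ pre) (cong head (sym split))) (last-∷ʳ pre)

    arm-comparable : ∀ {m xs s₂ s₃} → Arm m xs → s₂ ∈ m ∷ xs → s₃ ∈ m ∷ xs →
                     s₂ ∈ root-path s₃ ⊎ s₃ ∈ root-path s₂
    arm-comparable {m} {xs} arm s₂∈ s₃∈ with ∈-∃++ s₂∈ | ∈-∃++ s₃∈
    ... | pre₂ , _ , split₂ | pre₃ , _ , split₃ =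
      Sum.map (on-root-path pre₃ split₃) (on-root-path pre₂ split₂)
        (∈-++-∷-comparable pre₂ pre₃ (trans (sym split₂) split₃))
      where
      on-root-path : ∀ pre {x z post} → m ∷ xs ≡ pre ++ z ∷ post → x ∈ pre ∷ʳ z → x ∈ root-path z
      on-root-path pre split x∈ =
        subst (_ ∈_) (sym (root-path-along-arm arm pre split)) (∈-++⁺ʳ (root-path-init _) x∈)

    ∉-root-path-init : ∀ {m xs z} → Arm m xs → z ∈ m ∷ xs → z ∉ root-path-init m
    ∉-root-path-init arm z∈ z∈init with ∈-∃++ z∈
    ... | pre , _ , split = Unique-++⇒Disjoint (root-path-init _)
      (subst Unique (root-path-along-arm arm pre split) (proj₂ root-path-simple))
      (z∈init , ∈-++⁺ʳ pre (here refl))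

    above-on-arm : ∀ {m xs ys s₁ s} → Arm m xs → Arm m ys → Disjoint xs ys → s₁ ∈ xs →
                   s ∈ m ∷ xs ⊎ s ∈ m ∷ ys → s₁ ∈ root-path s → s ∈ m ∷ xs
    above-on-arm _    _    _        _    (inj₁ s∈X) _ = s∈X
    above-on-arm armX armY disjoint s₁∈xs (inj₂ s∈Y) s₁∈ with ∈-∃++ s∈Y
    ... | pre , _ , split
      with ∈-++⁻ (root-path-init _) (subst (_ ∈_) (root-path-along-arm armY pre split) s₁∈)
    ... | inj₁ s₁∈init = ⊥-elim (∉-root-path-init armX (there s₁∈xs) s₁∈init)
    ... | inj₂ s₁∈pre with subst (_ ∈_) (sym split) (∈-∷ʳ⇒∈-++-∷ pre s₁∈pre)
    ...   | here refl   = ⊥-elim (Unique[x∷xs]⇒x∉xs (proj₂ (proj₁ armX)) s₁∈xs)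
    ...   | there s₁∈ys = ⊥-elim (disjoint (s₁∈xs , s₁∈ys))

    comparable-above-fork : ∀ {m xs ys s₁ s₂ s₃} → Arm m xs → Arm m ys → Disjoint xs ys → s₁ ∈ xs →
                            s₂ ∈ m ∷ xs ⊎ s₂ ∈ m ∷ ys → s₃ ∈ m ∷ xs ⊎ s₃ ∈ m ∷ ys →
                            s₁ ∈ root-path s₂ → s₁ ∈ root-path s₃ → s₂ ∈ root-path s₃ ⊎ s₃ ∈ root-path s₂
    comparable-above-fork armX armY disjoint s₁∈xs s₂∈ s₃∈ s₁∈ρ₂ s₁∈ρ₃ = arm-comparable armX
      (above-on-arm armX armY disjoint s₁∈xs s₂∈ s₁∈ρ₂) (above-on-arm armX armY disjoint s₁∈xs s₃∈ s₁∈ρ₃)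

    comparable-above-min : ∀ {N : V → Set} {m s₁ s₂ s₃} → IsPathVertexSet A N →
      N m → (∀ t → N t → m ≼ t) → N s₁ → N s₂ → N s₃ → m ≢ s₁ → s₁ ≼ s₂ → s₁ ≼ s₃ →
      s₂ ≼ s₃ ⊎ s₃ ≼ s₂
    comparable-above-min {N} {m} {s₁} {s₂} {s₃} (P , isPath , ∈P⇔N) Nm min Ns₁ Ns₂ Ns₃ m≢s₁ s₁≼s₂ s₁≼s₃
      with ∈-∃++ (Equivalence.from (∈P⇔N m) Nm)
    ... | L , R , refl = Sum.map ∈-root-path⇒≼ ∈-root-path⇒≼ (by-side-of-s₁ (side Ns₁))
      where
      path : SimplePath A (L ++ m ∷ R)
      path = IsPath.linked isPath , IsPath.distinct isPath
      above-m : ∀ {t} → t ∈ L ++ m ∷ R → m ∈ root-path t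
      above-m t∈ = ≼⇒∈-root-path (min _ (Equivalence.to (∈P⇔N _) t∈))
      armR : Arm m R
      armR = proj₁ (SimplePath-split (IsTree.sym T _ _) L path) , above-m ∘ ∈-++⁺ʳ L
      armL : Arm m (reverse L)
      armL = proj₂ (SimplePath-split (IsTree.sym T _ _) L path) , above-m ∘ ∈-∷-reverse⇒∈-++-∷ L
      disjoint : Disjoint R (reverse L)
      disjoint = Unique-++-∷⇒Disjoint L (proj₂ path)
      side : ∀ {s} → N s → s ∈ m ∷ R ⊎ s ∈ m ∷ reverse L
      side Ns = ∈-++-∷⁻ L (Equivalence.from (∈P⇔N _) Ns)
      by-side-of-s₁ : s₁ ∈ m ∷ R ⊎ s₁ ∈ m ∷ reverse L → s₂ ∈ root-path s₃ ⊎ s₃ ∈ root-path s₂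
      by-side-of-s₁ (inj₁ (here s₁≡m)) = ⊥-elim (m≢s₁ (sym s₁≡m))
      by-side-of-s₁ (inj₂ (here s₁≡m)) = ⊥-elim (m≢s₁ (sym s₁≡m))
      by-side-of-s₁ (inj₁ (there s₁∈R)) = comparable-above-fork armR armL disjoint s₁∈R
        (side Ns₂) (side Ns₃) (≼⇒∈-root-path s₁≼s₂) (≼⇒∈-root-path s₁≼s₃)
      by-side-of-s₁ (inj₂ (there s₁∈L)) = comparable-above-fork armL armR (Disjoint.sym disjoint) s₁∈L
        (Sum.swap (side Ns₂)) (Sum.swap (side Ns₃)) (≼⇒∈-root-path s₁≼s₂) (≼⇒∈-root-path s₁≼s₃)

lemma13 : {nH nV : ℕ} (G : TPIG nH nV) → let open TPIGOrder G in
    (s₀ s₁ s₂ s₃ : Vtx) →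
    Γ s₀ s₁ → Γ s₀ s₂ → Γ s₀ s₃ →
    (m : Vtx) → IsMinΓ s₀ m →
    m <ᵍ s₁ → s₁ ≤ᵍ s₂ → s₁ ≤ᵍ s₃ →
    Comparable s₂ s₃
lemma13 G (inj₁ h) (inj₂ a) (inj₂ b) (inj₂ c) Γa Γb Γc (inj₂ m) (Γm , min) (_ , m≢a) a≤b a≤c =
  Rooted.comparable-above-min vroot (Γh-path h) Γm (min ∘ inj₂) Γa Γb Γc (m≢a ∘ cong inj₂) a≤b a≤c
  where open TPIG G; open TreePaths Fin._≟_ TV-tree
lemma13 G (inj₂ v) (inj₁ a) (inj₁ b) (inj₁ c) Γa Γb Γc (inj₁ m) (Γm , min) (_ , m≢a) a≤b a≤c =
  Rooted.comparable-above-min hroot (Γv-path v) Γm (min ∘ inj₁) Γa Γb Γc (m≢a ∘ cong inj₁) a≤b a≤c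
  where open TPIG G; open TreePaths Fin._≟_ TH-tree
lemma13 G (inj₁ _) (inj₁ _) _        _        () _  _  _ _ _ _ _
lemma13 G (inj₁ _) (inj₂ _) (inj₁ _) _        _  () _  _ _ _ _ _
lemma13 G (inj₁ _) (inj₂ _) (inj₂ _) (inj₁ _) _  _  () _ _ _ _ _
lemma13 G (inj₁ _) (inj₂ _) (inj₂ _) (inj₂ _) _  _  _  (inj₁ _) (() , _) _ _ _
lemma13 G (inj₂ _) (inj₂ _) _        _        () _  _  _ _ _ _ _
lemma13 G (inj₂ _) (inj₁ _) (inj₂ _) _        _  () _  _ _ _ _ _
lemma13 G (inj₂ _) (inj₁ _) (inj₁ _) (inj₂ _) _  _  () _ _ _ _ _
lemma13 G (inj₂ _) (inj₁ _) (inj₁ _) (inj₁ _) _  _  _  (inj₂ _) (() , _) _ _ _
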